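{- Let $G_2$ be the graph consisting of a $5$-cycle $C_2=v_1u_2v_3u_4u_5$ (edges $v_1u_2,u_2v_3,v_3u_4,u_4u_5,u_5v_1$), a vertex $y_1$ adjacent to all five vertices of $C_2$, a triangle $y_2y_3y_4$, and the edge $y_1y_2$. Let $L_2(v)=\{1,\dots,6\}$ for every $v\in V(C_2)$, $L_2(y_1)=\{1,\dots,8\}$, $L_2(y_2)=L_2(y_4)=\{1,2,3,4,7,8\}$ and $L_2(y_3)=\{1,2,3,4\}$. Then the gadget $(G_2,L_2)$ is $(v_1,v_3,\{y_4\})$-relaxed, and $\varphi(y_4)\cap\{7,8\}\neq\varnothing$ for every $(L_2:2)$-coloring $\varphi$ of $G_2$.
   Context: A list assignment $L$ for a graph $G$ assigns to each vertex $v$ a set $L(v)$ of colors. An $L$-coloring of $G$ is a proper vertex coloring $c$ with $c(v)\in L(v)$ for all $v$. For $S\subseteq V(G)$, an $L$-coloring of $S$ is an $L$-coloring of the induced subgraph $G[S]$; if $S\subseteq S'$ and $\varphi'$ is an $L$-coloring of $S'$, then $\varphi'$ extends an $L$-coloring $\varphi$ of $S$ if $\varphi'|_S=\varphi$. An $(L:2)$-coloring assigns to each vertex $v$ a $2$-element subset $\varphi(v)\subseteq L(v)$ such that adjacent vertices receive disjoint sets. A gadget is a pair $(G,L_0)$ where $L_0$ is a list assignment with all lists of even size; a half-list assignment for $(G,L_0)$ is any list assignment $L$ with $|L(v)|=|L_0(v)|/2$ for all $v$. For distinct vertices $v_1,v_3$ and a set $S\subseteq V(G)\setminus\{v_1,v_3\}$,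 the gadget is $(v_1,v_3,S)$-relaxed if every half-list assignment $L$ satisfies at least one of: (i) there is an $L$-coloring $\psi_0$ of $\{v_1,v_3\}$ such that every $L$-coloring of $S\cup\{v_1,v_3\}$ extending $\psi_0$ extends to an $L$-coloring of $G$; (ii) $L(v_1)=L(v_3)$ and there is an $L$-coloring $\psi_0$ of $S$ such that every $L$-coloring of $S\cup\{v_1,v_3\}$ extending $\psi_0$ extends to an $L$-coloring of $G$. -}

module Defs where

open import Data.Nat using (ℕ; _*_)
open import Data.Fin using (Fin)
import Data.Fin
import Data.Unit
open import Data.List using (List; []; _∷_; length)
open import Data.List.Membership.Propositional using (_∈_)
open import Data.List.Relation.Unary.Unique.Propositional using (Unique)
open import Data.Product using (_×_; _,_; Σ; ∃)
open import Data.Sum using (_⊎_)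
open import Relation.Binary.PropositionalEquality using (_≡_; _≢_)
open import Relation.Nullary using (¬_)
open import Function.Bundles using (_⇔_)

Adj : {n : ℕ} → List (Fin n × Fin n) → Fin n → Fin n → Set
Adj E u v = ((u , v) ∈ E) ⊎ ((v , u) ∈ E)

-- Colours are natural numbers; a list assignment gives each vertex a
-- finite set of colours, represented as a duplicate-free list.
ListAssignment : ℕ → Set
ListAssignment n = Fin n → List ℕ

VSet : ℕ → Set₁
VSet n = Fin n → Set

Everything : {n : ℕ} → VSet n
Everything _ = Data.Unit.⊤

-- An L-colouring of S (= of G[S]); a colouring is a total function but
-- only its values on S matter.
IsLColoring : {n : ℕ} → List (Fin n × Fin n) → ListAssignment n → VSet n → (Fin n → ℕ) → Set
IsLColoring E L S c =
  (∀ v → S v → c v ∈ L v) ×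
  (∀ u v → S u → S v → Adj E u v → c u ≢ c v)

AgreeOn : {n : ℕ} → VSet n → (Fin n → ℕ) → (Fin n → ℕ) → Set
AgreeOn S φ' φ = ∀ v → S v → φ' v ≡ φ v

IsHalfListAssignment : {n : ℕ} → ListAssignment n → ListAssignment n → Set
IsHalfListAssignment L0 L = ∀ v → Unique (L v) × (length (L v) * 2 ≡ length (L0 v))

Pair : {n : ℕ} → Fin n → Fin n → VSet n
Pair a b v = (v ≡ a) ⊎ (v ≡ b)

WithPair : {n : ℕ} → List (Fin n) → Fin n → Fin n → VSet n
WithPair S a b v = (v ∈ S) ⊎ Pair a b v

AllExtend : {n : ℕ} → List (Fin n × Fin n) → ListAssignment n →
            List (Fin n) → Fin n → Fin n → VSet n → (Fin n → ℕ) → Set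
AllExtend E L S v1 v3 D ψ0 =
  ∀ φ → IsLColoring E L (WithPair S v1 v3) φ → AgreeOn D φ ψ0 →
  ∃ λ c → IsLColoring E L Everything c × AgreeOn (WithPair S v1 v3) c φ

-- The gadget (G , L0) is (v1, v3, S)-relaxed (v1 ≠ v3, S avoids v1, v3).
Relaxed : {n : ℕ} → List (Fin n × Fin n) → ListAssignment n →
          Fin n → Fin n → List (Fin n) → Set
Relaxed E L0 v1 v3 S =
  ∀ L → IsHalfListAssignment L0 L →
    (∃ λ ψ0 → IsLColoring E L (Pair v1 v3) ψ0 × AllExtend E L S v1 v3 (Pair v1 v3) ψ0)
    ⊎
    ((∀ c → (c ∈ L v1) ⇔ (c ∈ L v3)) ×
     ∃ λ ψ0 → IsLColoring E L (_∈ S) ψ0 × AllExtend E L S v1 v3 (_∈ S) ψ0)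

TwoSet : Set
TwoSet = ℕ × ℕ

_∈₂_ : ℕ → TwoSet → Set
x ∈₂ (a , b) = (x ≡ a) ⊎ (x ≡ b)

IsL2Coloring : {n : ℕ} → List (Fin n × Fin n) → ListAssignment n → (Fin n → TwoSet) → Set
IsL2Coloring E L φ =
  (∀ v → Data.Product.proj₁ (φ v) ≢ Data.Product.proj₂ (φ v)) ×
  (∀ v x → x ∈₂ φ v → x ∈ L v) ×
  (∀ u v → Adj E u v → ∀ x → x ∈₂ φ u → ¬ (x ∈₂ φ v))

v₁ u₂ v₃ u₄ u₅ y₁ y₂ y₃ y₄ : Fin 9
v₁ = Data.Fin.#_ 0
u₂ = Data.Fin.#_ 1
v₃ = Data.Fin.#_ 2
u₄ = Data.Fin.#_ 3
u₅ = Data.Fin.#_ 4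
y₁ = Data.Fin.#_ 5
y₂ = Data.Fin.#_ 6
y₃ = Data.Fin.#_ 7
y₄ = Data.Fin.#_ 8

E₂ : List (Fin 9 × Fin 9)
E₂ = (v₁ , u₂) ∷ (u₂ , v₃) ∷ (v₃ , u₄) ∷ (u₄ , u₅) ∷ (u₅ , v₁) ∷
     (y₁ , v₁) ∷ (y₁ , u₂) ∷ (y₁ , v₃) ∷ (y₁ , u₄) ∷ (y₁ , u₅) ∷
     (y₂ , y₃) ∷ (y₃ , y₄) ∷ (y₄ , y₂) ∷
     (y₁ , y₂) ∷ []

L₂ : ListAssignment 9
L₂ v with Data.Fin.toℕ v
... | 5 = 1 ∷ 2 ∷ 3 ∷ 4 ∷ 5 ∷ 6 ∷ 7 ∷ 8 ∷ []
... | 6 = 1 ∷ 2 ∷ 3 ∷ 4 ∷ 7 ∷ 8 ∷ []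
... | 7 = 1 ∷ 2 ∷ 3 ∷ 4 ∷ []
... | 8 = 1 ∷ 2 ∷ 3 ∷ 4 ∷ 7 ∷ 8 ∷ []
... | _ = 1 ∷ 2 ∷ 3 ∷ 4 ∷ 5 ∷ 6 ∷ []

module Submission where

-- Halving L₂ leaves 3 colours on the rim v₁u₂v₃u₄u₅, 4 on the hub y₁ and 3, 2, 3 on y₂, y₃, y₄.
-- On the triangle, either every colour of y₄ completes, or only one colour b of y₁ can obstruct;
-- and some colour w₀ of y₄ always completes.  If some rim list has a colour α missing from the
-- list of its predecessor, colour the rim greedily starting from α with y₁ coloured neither b nor
-- α: this is alternative (i).  Otherwise the rim lists are all equal, y₁ takes a colour outside
-- them, every colouring of v₁, v₃ extends around the rim, and fixing y₄ = w₀ gives (ii).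
-- If an (L₂:2)-colouring avoided 7 and 8 on y₄, counting in {1,…,4} would force φ(y₂) = {7,8},
-- hence φ(y₁) ⊆ {1,…,6}; counting in {1,…,6} around y₁ then carries a colour of v₁ to v₃ and on
-- to its neighbour u₅.

open import Defs
open import Data.Empty using (⊥-elim)
open import Data.Nat using (ℕ; zero; suc; _≤_; _<_; _*_; _≟_; z<s; s<s; s≤s⁻¹)
open import Data.Fin as Fin using (Fin; _↑ˡ_)
open import Data.Fin.Patterns using (0F; 1F; 2F; 3F; 4F)
open import Data.Fin.Properties using (any?)
open import Data.List using (List; []; _∷_; [_]; length; concat; allFin; filter)
open import Data.List.Membership.Propositional using (_∈_; _∉_; find; lose)
open import Data.List.Membership.DecPropositional _≟_ using (_∈?_)
open import Data.List.Membership.Propositional.Properties using (∈-allFin; ∈-++⁻; ∈-filter⁺)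
open import Data.List.Properties using (filter-notAll)
open import Data.List.Relation.Binary.Disjoint.Propositional using (Disjoint)
open import Data.List.Relation.Binary.Subset.Propositional using (_⊆_)
open import Data.List.Relation.Unary.All as All using (All; []; _∷_)
import Data.List.Relation.Unary.All.Properties as All
open import Data.List.Relation.Unary.AllPairs using (AllPairs; []; _∷_)
open import Data.List.Relation.Unary.Any as Any using (here; there)
open import Data.List.Relation.Unary.Unique.Propositional using (Unique)
import Data.List.Relation.Unary.Unique.Propositional.Properties as Unique
open import Data.Nat.Properties using (≤-refl; ≤-trans; <-≤-trans; ≮⇒≥; n≮n; *-cancelʳ-≡)
open import Data.Product using (_×_; _,_; ∃; proj₁; proj₂)
open import Data.Product.Properties using (≡-dec)
open import Data.Sum using (_⊎_; inj₁; inj₂)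
open import Data.Unit using (tt)
import Data.Vec.Functional as V
open import Function using (_∘_)
open import Function.Bundles using (_⇔_; mk⇔)
open import Relation.Binary.PropositionalEquality using (_≡_; _≢_; refl; sym; trans; subst; ≢-sym)
open import Relation.Nullary using (¬_; Dec; yes; no)
open import Relation.Nullary.Decidable using (True; toWitness; map′; ¬?; _⊎-dec_; decidable-stable)

∈∧∉⇒≢ : ∀ {a b : ℕ} {A} → a ∈ A → b ∉ A → a ≢ b
∈∧∉⇒≢ a∈A b∉A a≡b = b∉A (subst (_∈ _) a≡b a∈A)

∃-∉ : ∀ {l F : List ℕ} → Unique l → length F < length l → ∃ λ z → z ∈ l × z ∉ F
∃-∉ {x ∷ xs} {F} (x∉xs ∷ xs-unique) F<l with x ∈? F
... | no x∉F = x , here refl , x∉F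
... | yes x∈F =
  let z , z∈xs , z∉F-x = ∃-∉ xs-unique (<-≤-trans F-x<F (s≤s⁻¹ F<l))
  in z , there z∈xs , λ z∈F → z∉F-x (∈-filter⁺ (≢? x) z∈F (All.lookup x∉xs z∈xs))
  where
  ≢? : ∀ a b → Dec (a ≢ b)
  ≢? a b = ¬? (a ≟ b)
  F-x<F : length (filter (≢? x) F) < length F
  F-x<F = filter-notAll (≢? x) F (Any.map (λ x≡y x≢y → x≢y x≡y) x∈F)

unique-length-≤ : ∀ {l F : List ℕ} → Unique l → All (_∈ F) l → length l ≤ length F
unique-length-≤ l-unique l⊆F = ≮⇒≥ λ F<l →
  let z , z∈l , z∉F = ∃-∉ l-unique F<l in z∉F (All.lookup l⊆F z∈l)

disjoint-length-≤ : ∀ {xss : List (List ℕ)} {F} → All Unique xss → AllPairs Disjoint xss →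
                    All (All (_∈ F)) xss → length (concat xss) ≤ length F
disjoint-length-≤ unique disjoint ⊆F =
  unique-length-≤ (Unique.concat⁺ unique disjoint) (All.concat⁺ ⊆F)

∃∉? : (A B : List ℕ) → Dec (∃ λ z → z ∈ A × z ∉ B)
∃∉? A B = map′ find (λ (_ , z∈A , z∉B) → lose z∈A z∉B) (Any.any? (λ z → ¬? (z ∈? B)) A)

¬∃∉⇒⊆ : ∀ {A B : List ℕ} → ¬ (∃ λ z → z ∈ A × z ∉ B) → A ⊆ B
¬∃∉⇒⊆ {B = B} none {z} z∈A = decidable-stable (z ∈? B) λ z∉B → none (z , z∈A , z∉B)

Sized : ℕ → List ℕ → Set
Sized n l = Unique l × length l ≡ n

pick : ∀ {n l} → Sized n l → ∀ F → length F < n → ∃ λ z → z ∈ l × z ∉ F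
pick (l-unique , refl) F F<n = ∃-∉ l-unique F<n

pick-∉ : ∀ {m n l F} → Sized m l → Sized n F → n < m → ∃ λ z → z ∈ l × z ∉ F
pick-∉ l-size (_ , refl) = pick l-size _

-- Colours for y₂ and y₃ once y₁ is coloured x and y₄ is coloured w.
record TriangleColouring (Y₂ Y₃ : List ℕ) (x w : ℕ) : Set where
  field
    c₂ c₃ : ℕ
    c₂∈Y₂ : c₂ ∈ Y₂
    c₃∈Y₃ : c₃ ∈ Y₃
    c₂≢c₃ : c₂ ≢ c₃
    c₂≢w : c₂ ≢ w
    c₃≢w : c₃ ≢ w
    c₂≢x : c₂ ≢ x

module _ {Y₂ Y₃ : List ℕ} (Y₂-size : Sized 3 Y₂) (Y₃-size : Sized 2 Y₃) where

  triangle-⊈ : ∀ {z} → z ∈ Y₃ → z ∉ Y₂ → ∀ x w → TriangleColouring Y₂ Y₃ x w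
  triangle-⊈ {z} z∈Y₃ z∉Y₂ x w with w ≟ z
  ... | yes refl with pick Y₃-size [ w ] ≤-refl
  ...   | c₃ , c₃∈ , c₃∉ with pick Y₂-size (x ∷ c₃ ∷ []) ≤-refl
  ...     | c₂ , c₂∈ , c₂∉ =
    record { c₂∈Y₂ = c₂∈ ; c₃∈Y₃ = c₃∈ ; c₂≢c₃ = c₂∉ ∘ there ∘ here
           ; c₂≢w = ∈∧∉⇒≢ c₂∈ z∉Y₂ ; c₃≢w = c₃∉ ∘ here ; c₂≢x = c₂∉ ∘ here }
  triangle-⊈ {z} z∈Y₃ z∉Y₂ x w | no w≢z with pick Y₂-size (w ∷ x ∷ []) ≤-refl
  ... | c₂ , c₂∈ , c₂∉ =
    record { c₂∈Y₂ = c₂∈ ; c₃∈Y₃ = z∈Y₃ ; c₂≢c₃ = ∈∧∉⇒≢ c₂∈ z∉Y₂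
           ; c₂≢w = c₂∉ ∘ here ; c₃≢w = ≢-sym w≢z ; c₂≢x = c₂∉ ∘ there ∘ here }

  triangle-∉ : Y₃ ⊆ Y₂ → ∀ x {w} → w ∉ Y₃ → TriangleColouring Y₂ Y₃ x w
  triangle-∉ Y₃⊆Y₂ x w∉Y₃ with pick Y₃-size [ x ] ≤-refl
  ... | c₂ , c₂∈ , c₂∉ with pick Y₃-size [ c₂ ] ≤-refl
  ... | c₃ , c₃∈ , c₃∉ =
    record { c₂∈Y₂ = Y₃⊆Y₂ c₂∈ ; c₃∈Y₃ = c₃∈ ; c₂≢c₃ = ≢-sym (c₃∉ ∘ here)
           ; c₂≢w = ∈∧∉⇒≢ c₂∈ w∉Y₃ ; c₃≢w = ∈∧∉⇒≢ c₃∈ w∉Y₃ ; c₂≢x = c₂∉ ∘ here }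

  triangle-∈ : ∀ {b} → b ∈ Y₂ → b ∉ Y₃ → ∀ {x} → x ≢ b → ∀ {w} → w ∈ Y₃ → TriangleColouring Y₂ Y₃ x w
  triangle-∈ {b} b∈Y₂ b∉Y₃ x≢b {w} w∈Y₃ with pick Y₃-size [ w ] ≤-refl
  ... | c₃ , c₃∈ , c₃∉ =
    record { c₂∈Y₂ = b∈Y₂ ; c₃∈Y₃ = c₃∈ ; c₂≢c₃ = ≢-sym (∈∧∉⇒≢ c₃∈ b∉Y₃)
           ; c₂≢w = ≢-sym (∈∧∉⇒≢ w∈Y₃ b∉Y₃) ; c₃≢w = c₃∉ ∘ here ; c₂≢x = ≢-sym x≢b }

  triangle-except : ∃ λ b → ∀ x → x ≢ b → ∀ w → TriangleColouring Y₂ Y₃ x w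
  triangle-except with ∃∉? Y₃ Y₂
  ... | yes (z , z∈Y₃ , z∉Y₂) = 0 , λ x _ → triangle-⊈ z∈Y₃ z∉Y₂ x
  ... | no none with pick-∉ Y₂-size Y₃-size ≤-refl
  ...   | b , b∈Y₂ , b∉Y₃ = b , extend
    where
    extend : ∀ x → x ≢ b → ∀ w → TriangleColouring Y₂ Y₃ x w
    extend x x≢b w with w ∈? Y₃
    ... | yes w∈Y₃ = triangle-∈ b∈Y₂ b∉Y₃ x≢b w∈Y₃
    ... | no w∉Y₃ = triangle-∉ (¬∃∉⇒⊆ none) x w∉Y₃

  triangle-at : ∀ {Y₄} → Sized 3 Y₄ → ∃ λ w → w ∈ Y₄ × ∀ x → TriangleColouring Y₂ Y₃ x w
  triangle-at Y₄-size with ∃∉? Y₃ Y₂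
  ... | yes (z , z∈Y₃ , z∉Y₂) with pick Y₄-size [] z<s
  ...   | w , w∈Y₄ , _ = w , w∈Y₄ , λ x → triangle-⊈ z∈Y₃ z∉Y₂ x w
  triangle-at Y₄-size | no none with pick-∉ Y₄-size Y₃-size ≤-refl
  ... | w , w∈Y₄ , w∉Y₃ = w , w∈Y₄ , λ x → triangle-∉ (¬∃∉⇒⊆ none) x w∉Y₃

next prev : Fin 5 → Fin 5
next 0F = 1F
next 1F = 2F
next 2F = 3F
next 3F = 4F
next 4F = 0F
prev 0F = 4F
prev 1F = 0F
prev 2F = 1F
prev 3F = 2F
prev 4F = 3F

next-prev : ∀ i → next (prev i) ≡ i
next-prev = λ { 0F → refl ; 1F → refl ; 2F → refl ; 3F → refl ; 4F → refl }

prev-next : ∀ i → prev (next i) ≡ i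
prev-next = λ { 0F → refl ; 1F → refl ; 2F → refl ; 3F → refl ; 4F → refl }

record RimColouring (R : Fin 5 → List ℕ) (x : ℕ) (k : Fin 5 → ℕ) : Set where
  field
    k∈R : ∀ i → k i ∈ R i
    k≢x : ∀ i → k i ≢ x
    k≢next : ∀ i → k i ≢ k (next i)

module _ {R : Fin 5 → List ℕ} {x : ℕ} where

  rotate : ∀ {k} → RimColouring (R ∘ next) x k → RimColouring R x (k ∘ prev)
  rotate {k} col = record
    { k∈R = λ i → subst (λ j → k (prev i) ∈ R j) (next-prev i) (k∈R (prev i))
    ; k≢x = k≢x ∘ prev
    ; k≢next = λ i → subst (λ j → k (prev i) ≢ k j)
                           (trans (next-prev i) (sym (prev-next i))) (k≢next (prev i))
    }
    where open RimColouring col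

shift : ℕ → Fin 5 → Fin 5
shift zero = λ i → i
shift (suc n) = shift n ∘ next

unrotate : ∀ n {R x} → ∃ (RimColouring (R ∘ shift n) x) → ∃ (RimColouring R x)
unrotate zero col = col
unrotate (suc n) (_ , col) = unrotate n (_ , rotate col)

cyclic-⊆ : ∀ {R : Fin 5 → List ℕ} → (∀ i → R (next i) ⊆ R i) → ∀ i j → R i ⊆ R j
cyclic-⊆ {R} ⊆prev i j z∈ = from-0F j (to-0F i z∈)
  where
  to-0F : ∀ i → R i ⊆ R 0F
  to-0F 0F z∈ = z∈
  to-0F 1F z∈ = ⊆prev 0F z∈
  to-0F 2F z∈ = ⊆prev 0F (⊆prev 1F z∈)
  to-0F 3F z∈ = ⊆prev 0F (⊆prev 1F (⊆prev 2F z∈))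
  to-0F 4F z∈ = ⊆prev 0F (⊆prev 1F (⊆prev 2F (⊆prev 3F z∈)))
  from-0F : ∀ j → R 0F ⊆ R j
  from-0F 0F z∈ = z∈
  from-0F 4F z∈ = ⊆prev 4F z∈
  from-0F 3F z∈ = ⊆prev 3F (⊆prev 4F z∈)
  from-0F 2F z∈ = ⊆prev 2F (⊆prev 3F (⊆prev 4F z∈))
  from-0F 1F z∈ = ⊆prev 1F (⊆prev 2F (⊆prev 3F (⊆prev 4F z∈)))

RimExtends : (Fin 5 → List ℕ) → ℕ → Set
RimExtends R x = ∀ {k₀ k₂} → k₀ ∈ R 0F → k₂ ∈ R 2F →
                 ∃ λ k → RimColouring R x k × k 0F ≡ k₀ × k 2F ≡ k₂

module _ {R : Fin 5 → List ℕ} (R-size : ∀ i → Sized 3 (R i)) where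

  rim-greedy : ∀ {α x} → α ∈ R 0F → α ∉ R 4F → α ≢ x → ∃ (RimColouring R x)
  rim-greedy {α} {x} α∈ α∉ α≢x with pick (R-size 1F) (α ∷ x ∷ []) ≤-refl
  ... | k₁ , k₁∈ , k₁∉ with pick (R-size 2F) (k₁ ∷ x ∷ []) ≤-refl
  ... | k₂ , k₂∈ , k₂∉ with pick (R-size 3F) (k₂ ∷ x ∷ []) ≤-refl
  ... | k₃ , k₃∈ , k₃∉ with pick (R-size 4F) (k₃ ∷ x ∷ []) ≤-refl
  ... | k₄ , k₄∈ , k₄∉ = k , record
    { k∈R = λ { 0F → α∈ ; 1F → k₁∈ ; 2F → k₂∈ ; 3F → k₃∈ ; 4F → k₄∈ }
    ; k≢x = λ { 0F → α≢x ; 1F → k₁∉ ∘ there ∘ here ; 2F → k₂∉ ∘ there ∘ here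
              ; 3F → k₃∉ ∘ there ∘ here ; 4F → k₄∉ ∘ there ∘ here }
    ; k≢next = λ { 0F → ≢-sym (k₁∉ ∘ here) ; 1F → ≢-sym (k₂∉ ∘ here) ; 2F → ≢-sym (k₃∉ ∘ here)
                 ; 3F → ≢-sym (k₄∉ ∘ here) ; 4F → ∈∧∉⇒≢ k₄∈ α∉ }
    }
    where
    k : Fin 5 → ℕ
    k 0F = α
    k 1F = k₁
    k 2F = k₂
    k 3F = k₃
    k 4F = k₄

  rim-fixing : ∀ {x} → (∀ i → x ∉ R i) → RimExtends R x
  rim-fixing {x} x∉R {k₀} {k₂} k₀∈ k₂∈ with pick (R-size 1F) (k₀ ∷ k₂ ∷ []) ≤-refl
  ... | k₁ , k₁∈ , k₁∉ with pick (R-size 3F) [ k₂ ] (s<s z<s)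
  ... | k₃ , k₃∈ , k₃∉ with pick (R-size 4F) (k₃ ∷ k₀ ∷ []) ≤-refl
  ... | k₄ , k₄∈ , k₄∉ = k , record
    { k∈R = k∈R
    ; k≢x = λ i → ∈∧∉⇒≢ (k∈R i) (x∉R i)
    ; k≢next = λ { 0F → ≢-sym (k₁∉ ∘ here) ; 1F → k₁∉ ∘ there ∘ here ; 2F → ≢-sym (k₃∉ ∘ here)
                 ; 3F → ≢-sym (k₄∉ ∘ here) ; 4F → k₄∉ ∘ there ∘ here }
    } , refl , refl
    where
    k : Fin 5 → ℕ
    k 0F = k₀
    k 1F = k₁
    k 2F = k₂
    k 3F = k₃
    k 4F = k₄
    k∈R : ∀ i → k i ∈ R i
    k∈R = λ { 0F → k₀∈ ; 1F → k₁∈ ; 2F → k₂∈ ; 3F → k₃∈ ; 4F → k₄∈ }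

module _ {R : Fin 5 → List ℕ} (R-size : ∀ i → Sized 3 (R i)) where

  -- shift n maps the edge 4F — 0F onto i — next i.
  rim-fresh : ∀ i {α x} → α ∈ R (next i) → α ∉ R i → α ≢ x → ∃ (RimColouring R x)
  rim-fresh 0F α∈ α∉ α≢x = unrotate 1 {R} (rim-greedy (R-size ∘ shift 1) α∈ α∉ α≢x)
  rim-fresh 1F α∈ α∉ α≢x = unrotate 2 {R} (rim-greedy (R-size ∘ shift 2) α∈ α∉ α≢x)
  rim-fresh 2F α∈ α∉ α≢x = unrotate 3 {R} (rim-greedy (R-size ∘ shift 3) α∈ α∉ α≢x)
  rim-fresh 3F α∈ α∉ α≢x = unrotate 4 {R} (rim-greedy (R-size ∘ shift 4) α∈ α∉ α≢x)
  rim-fresh 4F α∈ α∉ α≢x = rim-greedy R-size α∈ α∉ α≢x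

  wheel : ∀ {Y} → Sized 4 Y → ∀ b →
    (∃ λ x → x ∈ Y × x ≢ b × ∃ (RimColouring R x)) ⊎
    ((∀ c → (c ∈ R 0F) ⇔ (c ∈ R 2F)) × ∃ λ x → x ∈ Y × RimExtends R x)
  wheel Y-size b with any? (λ i → ∃∉? (R (next i)) (R i))
  ... | yes (i , α , α∈ , α∉) with pick Y-size (b ∷ α ∷ []) (s<s (s<s z<s))
  ...   | x , x∈Y , x∉ = inj₁ (x , x∈Y , x∉ ∘ here , rim-fresh i α∈ α∉ (≢-sym (x∉ ∘ there ∘ here)))
  wheel Y-size b | no none with pick-∉ Y-size (R-size 0F) ≤-refl
  ... | x , x∈Y , x∉R₀ =
    inj₂ ((λ c → mk⇔ (R⊆R 0F 2F) (R⊆R 2F 0F)) , x , x∈Y , rim-fixing R-size (λ i x∈ → x∉R₀ (R⊆R i 0F x∈)))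
    where
    R⊆R : ∀ i j → R i ⊆ R j
    R⊆R = cyclic-⊆ (λ i → ¬∃∉⇒⊆ (λ fresh → none (i , fresh)))

module _ {n : ℕ} {E : List (Fin n × Fin n)} {L : ListAssignment n} where

  colouring-from-All : ∀ {c} → All (λ v → c v ∈ L v) (allFin n) →
                       All (λ e → c (proj₁ e) ≢ c (proj₂ e)) E → IsLColoring E L Everything c
  colouring-from-All c∈L edges-proper =
    (λ v _ → All.lookup c∈L (∈-allFin v)) , λ where
      u v _ _ (inj₁ uv∈E) → All.lookup edges-proper uv∈E
      u v _ _ (inj₂ vu∈E) → ≢-sym (All.lookup edges-proper vu∈E)

  restrict : ∀ {S c} → IsLColoring E L Everything c → IsLColoring E L S c
  restrict (c∈L , proper) = (λ v _ → c∈L v tt) , λ u v _ _ → proper u v tt tt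

half-sized : ∀ {L} → IsHalfListAssignment L₂ L → ∀ v {m} → length (L₂ v) ≡ m * 2 → Sized m (L v)
half-sized {L} half v {m} L₂-length =
  proj₁ (half v) , *-cancelʳ-≡ (length (L v)) m 2 (trans (proj₂ (half v)) L₂-length)

rim : Fin 5 → Fin 9
rim i = i ↑ˡ 4

-- The rim v₁u₂v₃u₄u₅ of the wheel is 0F … 4F in cycle order, followed by y₁, y₂, y₃, y₄.
gadget-colouring : (Fin 5 → ℕ) → ℕ → ℕ → ℕ → ℕ → Fin 9 → ℕ
gadget-colouring k x c₂ c₃ w = k V.++ (x V.∷ c₂ V.∷ c₃ V.∷ w V.∷ V.[])

module _ {L : ListAssignment 9} {k x w} (rim-col : RimColouring (L ∘ rim) x k) (x∈L : x ∈ L y₁)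
         (tri : TriangleColouring (L y₂) (L y₃) x w) (w∈L : w ∈ L y₄) where
  open RimColouring rim-col
  open TriangleColouring tri

  gadget-proper : IsLColoring E₂ L Everything (gadget-colouring k x c₂ c₃ w)
  gadget-proper = colouring-from-All
    (k∈R 0F ∷ k∈R 1F ∷ k∈R 2F ∷ k∈R 3F ∷ k∈R 4F ∷ x∈L ∷ c₂∈Y₂ ∷ c₃∈Y₃ ∷ w∈L ∷ [])
    (k≢next 0F ∷ k≢next 1F ∷ k≢next 2F ∷ k≢next 3F ∷ k≢next 4F ∷
     ≢-sym (k≢x 0F) ∷ ≢-sym (k≢x 1F) ∷ ≢-sym (k≢x 2F) ∷ ≢-sym (k≢x 3F) ∷ ≢-sym (k≢x 4F) ∷
     c₂≢c₃ ∷ c₃≢w ∷ ≢-sym c₂≢w ∷ ≢-sym c₂≢x ∷ [])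

agree-on-y₄v₁v₃ : ∀ {c φ : Fin 9 → ℕ} → c y₄ ≡ φ y₄ → c v₁ ≡ φ v₁ → c v₃ ≡ φ v₃ →
                  AgreeOn (WithPair (y₄ ∷ []) v₁ v₃) c φ
agree-on-y₄v₁v₃ y₄≡ v₁≡ v₃≡ = λ where
  _ (inj₁ (here refl)) → y₄≡
  _ (inj₂ (inj₁ refl)) → v₁≡
  _ (inj₂ (inj₂ refl)) → v₃≡

rim-sized : ∀ {L} → IsHalfListAssignment L₂ L → ∀ i → Sized 3 (L (rim i))
rim-sized half 0F = half-sized half v₁ refl
rim-sized half 1F = half-sized half u₂ refl
rim-sized half 2F = half-sized half v₃ refl
rim-sized half 3F = half-sized half u₄ refl
rim-sized half 4F = half-sized half u₅ refl

relaxed : Relaxed E₂ L₂ v₁ v₃ (y₄ ∷ [])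
relaxed L half
  with triangle-except (half-sized half y₂ refl) (half-sized half y₃ refl)
     | triangle-at (half-sized half y₂ refl) (half-sized half y₃ refl) (half-sized half y₄ refl)
... | b , except | w₀ , w₀∈L , at with wheel (rim-sized half) (half-sized half y₁ refl) b
... | inj₁ (x , x∈L , x≢b , k , rim-col) =
  inj₁ (_ , restrict (gadget-proper rim-col x∈L (except x x≢b w₀) w₀∈L) , extend)
  where
  extend : AllExtend E₂ L (y₄ ∷ []) v₁ v₃ (Pair v₁ v₃) _
  extend φ (φ∈L , _) φ≡ψ₀ =
    _ , gadget-proper rim-col x∈L (except x x≢b (φ y₄)) (φ∈L y₄ (inj₁ (here refl))) ,
    agree-on-y₄v₁v₃ refl (sym (φ≡ψ₀ v₁ (inj₁ refl))) (sym (φ≡ψ₀ v₃ (inj₂ refl)))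
... | inj₂ (v₁⇔v₃ , x , x∈L , rim-extends)
  -- Arbitrary colours k₀, k₂ of v₁, v₃ only serve to build ψ₀; alternative (ii) uses its value w₀ on y₄.
  with pick (rim-sized half 0F) [] z<s | pick (rim-sized half 2F) [] z<s
... | k₀ , k₀∈L , _ | k₂ , k₂∈L , _ with rim-extends k₀∈L k₂∈L
... | _ , rim-col , _ =
  inj₂ (v₁⇔v₃ , _ , restrict (gadget-proper rim-col x∈L (at x) w₀∈L) , extend)
  where
  extend : AllExtend E₂ L (y₄ ∷ []) v₁ v₃ (_∈ (y₄ ∷ [])) _
  extend φ (φ∈L , _) φ≡ψ₀ with rim-extends (φ∈L v₁ (inj₂ (inj₁ refl))) (φ∈L v₃ (inj₂ (inj₂ refl)))
  ... | _ , rim-col′ , k₀≡ , k₂≡ =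
    _ , gadget-proper rim-col′ x∈L (at x) w₀∈L , agree-on-y₄v₁v₃ (sym (φ≡ψ₀ y₄ (here refl))) k₀≡ k₂≡

toList₂ : TwoSet → List ℕ
toList₂ p = proj₁ p ∷ proj₂ p ∷ []

∈⇒∈₂ : ∀ {x p} → x ∈ toList₂ p → x ∈₂ p
∈⇒∈₂ (here x≡a) = inj₁ x≡a
∈⇒∈₂ (there (here x≡b)) = inj₂ x≡b

All-toList₂ : ∀ {P : ℕ → Set} {p} → (∀ {x} → x ∈₂ p → P x) → All P (toList₂ p)
All-toList₂ f = f (inj₁ refl) ∷ f (inj₂ refl) ∷ []

_∈₂?_ : ∀ x p → Dec (x ∈₂ p)
x ∈₂? p = (x ≟ proj₁ p) ⊎-dec (x ≟ proj₂ p)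

module L2Colouring {n} {E : List (Fin n × Fin n)} {L : ListAssignment n} {φ : Fin n → TwoSet}
                   (φ-col : IsL2Coloring E L φ) where

  colours-unique : ∀ v → Unique (toList₂ (φ v))
  colours-unique v = (proj₁ φ-col v ∷ []) ∷ [] ∷ []

  colour-∈ : ∀ {v x} → x ∈₂ φ v → x ∈ L v
  colour-∈ = proj₁ (proj₂ φ-col) _ _

  colours-⊆ : ∀ v → All (_∈ L v) (toList₂ (φ v))
  colours-⊆ v = All-toList₂ colour-∈

  adjacent-disjoint : ∀ {u v x} → Adj E u v → x ∈₂ φ u → ¬ x ∈₂ φ v
  adjacent-disjoint uv = proj₂ (proj₂ φ-col) _ _ uv _

  colours-disjoint : ∀ {u v} → Adj E u v → Disjoint (toList₂ (φ u)) (toList₂ (φ v))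
  colours-disjoint uv (x∈u , x∈v) = adjacent-disjoint uv (∈⇒∈₂ x∈u) (∈⇒∈₂ x∈v)

  colour-disjoint : ∀ {u v x} → Adj E u v → x ∈₂ φ v → Disjoint (toList₂ (φ u)) [ x ]
  colour-disjoint uv x∈v (x∈u , here refl) = adjacent-disjoint uv (∈⇒∈₂ x∈u) x∈v

  -- Seven pairwise distinct colours would be needed among h, u, v and x otherwise.
  colour-spreads : ∀ {F h w u v x} → length F ≤ 6 →
    Adj E h w → Adj E h u → Adj E h v → Adj E u w → Adj E u v →
    All (_∈ F) (toList₂ (φ h)) → All (_∈ F) (toList₂ (φ u)) → All (_∈ F) (toList₂ (φ v)) →
    x ∈ F → x ∈₂ φ w → x ∈₂ φ v
  colour-spreads {h = h} {u = u} {v = v} {x = x} F≤6 hw hu hv uw uv h⊆F u⊆F v⊆F x∈F x∈w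
    with x ∈₂? φ v
  ... | yes x∈v = x∈v
  ... | no x∉v = ⊥-elim (n≮n 6 (≤-trans seven≤F F≤6))
    where
    seven≤F = disjoint-length-≤ {xss = toList₂ (φ h) ∷ toList₂ (φ u) ∷ toList₂ (φ v) ∷ [ x ] ∷ []}
      (colours-unique h ∷ colours-unique u ∷ colours-unique v ∷ ([] ∷ []) ∷ [])
      ((colours-disjoint hu ∷ colours-disjoint hv ∷ colour-disjoint hw x∈w ∷ []) ∷
       (colours-disjoint uv ∷ colour-disjoint uw x∈w ∷ []) ∷
       ((λ { (x∈v , here refl) → x∉v (∈⇒∈₂ x∈v) }) ∷ []) ∷ [] ∷ [])
      (h⊆F ∷ u⊆F ∷ v⊆F ∷ (x∈F ∷ []) ∷ [])

adj? : ∀ {n} (E : List (Fin n × Fin n)) u v → Dec (Adj E u v)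
adj? E u v = Any.any? (≡-dec Fin._≟_ Fin._≟_ (u , v)) E ⊎-dec Any.any? (≡-dec Fin._≟_ Fin._≟_ (v , u)) E

edge : ∀ {u v} {uv : True (adj? E₂ u v)} → Adj E₂ u v
edge {uv = uv} = toWitness uv

y₄-meets-7-or-8 : ∀ φ → IsL2Coloring E₂ L₂ φ → (7 ∈₂ φ y₄) ⊎ (8 ∈₂ φ y₄)
y₄-meets-7-or-8 φ φ-col with 7 ∈₂? φ y₄ | 8 ∈₂? φ y₄
... | yes 7∈y₄ | _ = inj₁ 7∈y₄
... | no _ | yes 8∈y₄ = inj₂ 8∈y₄
... | no 7∉y₄ | no 8∉y₄ = ⊥-elim (adjacent-disjoint {u₅} {v₁} edge α∈u₅ α∈v₁)
  where
  open L2Colouring φ-col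

  y₄-low : ∀ {z} → z ∈₂ φ y₄ → z ∈ L₂ y₃
  y₄-low z∈y₄ with ∈-++⁻ (L₂ y₃) (colour-∈ z∈y₄)
  ... | inj₁ z∈low = z∈low
  ... | inj₂ (here refl) = ⊥-elim (7∉y₄ z∈y₄)
  ... | inj₂ (there (here refl)) = ⊥-elim (8∉y₄ z∈y₄)

  y₂-high : ∀ {z} → z ∈₂ φ y₂ → z ∈ 7 ∷ 8 ∷ []
  y₂-high {z} z∈y₂ with ∈-++⁻ (L₂ y₃) (colour-∈ z∈y₂)
  ... | inj₂ z∈high = z∈high
  ... | inj₁ z∈low = ⊥-elim (n≮n 4 (disjoint-length-≤
    {xss = toList₂ (φ y₃) ∷ toList₂ (φ y₄) ∷ [ z ] ∷ []}
    (colours-unique y₃ ∷ colours-unique y₄ ∷ ([] ∷ []) ∷ [])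
    ((colours-disjoint edge ∷ colour-disjoint edge z∈y₂ ∷ []) ∷ (colour-disjoint edge z∈y₂ ∷ []) ∷ [] ∷ [])
    (colours-⊆ y₃ ∷ All-toList₂ y₄-low ∷ (z∈low ∷ []) ∷ [])))

  y₁-low : ∀ {z} → z ∈₂ φ y₁ → z ∈ L₂ v₁
  y₁-low {z} z∈y₁ with ∈-++⁻ (L₂ v₁) (colour-∈ z∈y₁)
  ... | inj₁ z∈low = z∈low
  ... | inj₂ z∈high = ⊥-elim (n≮n 2 (disjoint-length-≤
    {xss = toList₂ (φ y₂) ∷ [ z ] ∷ []}
    (colours-unique y₂ ∷ ([] ∷ []) ∷ [])
    ((colour-disjoint edge z∈y₁ ∷ []) ∷ [] ∷ [])
    (All-toList₂ y₂-high ∷ (z∈high ∷ []) ∷ [])))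

  α∈v₁ : proj₁ (φ v₁) ∈₂ φ v₁
  α∈v₁ = inj₁ refl

  α∈v₃ : proj₁ (φ v₁) ∈₂ φ v₃
  α∈v₃ = colour-spreads {h = y₁} {v₁} {u₂} ≤-refl edge edge edge edge edge
           (All-toList₂ y₁-low) (colours-⊆ u₂) (colours-⊆ v₃) (colour-∈ α∈v₁) α∈v₁

  α∈u₅ : proj₁ (φ v₁) ∈₂ φ u₅
  α∈u₅ = colour-spreads {h = y₁} {v₃} {u₄} ≤-refl edge edge edge edge edge
           (All-toList₂ y₁-low) (colours-⊆ u₄) (colours-⊆ u₅) (colour-∈ α∈v₁) α∈v₃

lemma5 : Relaxed E₂ L₂ v₁ v₃ (y₄ ∷ [])
    × (∀ φ → IsL2Coloring E₂ L₂ φ → (7 ∈₂ φ y₄) ⊎ (8 ∈₂ φ y₄))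
lemma5 = relaxed , y₄-meets-7-or-8
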